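{- Let $\mathscr{C}$ be a set system on a finite set $V$ satisfying (L1): for all $A,B,C\in\mathscr{C}$, if $A\between B$ and $B\between C$, then $A\subseteq C$, or $C\subseteq A$, or $A\cap C\subseteq B\subseteq A\cup C$. Then $\mathscr{C}$ satisfies (P2): for all $A,B,C,D\in\mathscr{C}$ with $A\between D$, $B\between D$ and $C\between D$, we have $A\subseteq D\cup B\cup C$, or $B\subseteq D\cup A\cup C$, or $C\subseteq D\cup A\cup B$.
   Context: Sets $A,B$ overlap, written $A\between B$, if $A\cap B$, $A\setminus B$ and $B\setminus A$ are all non-empty. -}

module Defs where

open import Data.Nat using (ℕ)
open import Data.Product using (_×_)
open import Data.Sum using (_⊎_)
open import Data.Fin.Subset using (Subset; _⊆_; _∩_; _∪_; _─_; Nonempty)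

_≬_ : {n : ℕ} → Subset n → Subset n → Set
A ≬ B = Nonempty (A ∩ B) × Nonempty (A ─ B) × Nonempty (B ─ A)

SetSystem : ℕ → Set₁
SetSystem n = Subset n → Set

L1 : {n : ℕ} → SetSystem n → Set
L1 {n} 𝒞 = ∀ (A B C : Subset n) → 𝒞 A → 𝒞 B → 𝒞 C →
  A ≬ B → B ≬ C →
  (A ⊆ C) ⊎ (C ⊆ A) ⊎ ((A ∩ C ⊆ B) × (B ⊆ A ∪ C))

P2 : {n : ℕ} → SetSystem n → Set
P2 {n} 𝒞 = ∀ (A B C D : Subset n) → 𝒞 A → 𝒞 B → 𝒞 C → 𝒞 D →
  A ≬ D → B ≬ D → C ≬ D →
  (A ⊆ D ∪ B ∪ C) ⊎ (B ⊆ D ∪ A ∪ C) ⊎ (C ⊆ D ∪ A ∪ B)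

{-# OPTIONS --safe #-}
-- Suppose all three alternatives of (P2) fail, so each of A, B, C has a point
-- outside the other two.  For any two
-- X, Y of them, (L1) applied to X ≬ D ≬ Y cannot give X ⊆ Y or Y ⊆ X, hence
-- D ⊆ X ∪ Y.  A point of D ∖ C then lies in A ∩ B, so A ≬ B, and likewise
-- B ≬ C.  Now (L1) applied to A ≬ B ≬ C gives A ⊆ C, C ⊆ A or B ⊆ A ∪ C, each
-- refuted by one of the private points.
module Submission where

open import Data.Nat using (ℕ)
open import Data.Fin using (Fin)
open import Data.Product using (_×_; _,_; proj₂; ∃-syntax)
open import Data.Sum using (_⊎_; inj₁; inj₂)
open import Data.Empty using (⊥; ⊥-elim)
open import Data.Vec using (_∷_; here; there)
open import Data.Bool using (true; false)
open import Relation.Nullary using (yes; no; contradiction)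
open import Data.Fin.Subset using (Subset; _∈_; _∉_; _⊆_; _⊈_; _∩_; _∪_; _─_; Nonempty)
open import Data.Fin.Subset.Properties
  using (_∈?_; nonempty?; p─q⊆p; x∈p∧x∉q⇒x∈p─q; x∈p∩q⁺; x∈p∩q⁻; x∈p∪q⁺; x∈p∪q⁻)
open import Defs

private
  variable
    n : ℕ
    x : Fin n
    p q : Subset n

x∈p─q⇒x∉q : (p q : Subset n) → x ∈ p ─ q → x ∉ q
x∈p─q⇒x∉q (_ ∷ p) (_ ∷ q) (there x∈p─q) (there x∈q) = x∈p─q⇒x∉q p q x∈p─q x∈q
x∈p─q⇒x∉q (false ∷ p) (true ∷ q) () here
x∈p─q⇒x∉q (true ∷ p) (true ∷ q) () here

x∈p∪q∧x∉q⇒x∈p : x ∈ p ∪ q → x ∉ q → x ∈ p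
x∈p∪q∧x∉q⇒x∈p {p = p} {q = q} x∈p∪q x∉q with x∈p∪q⁻ p q x∈p∪q
... | inj₁ x∈p = x∈p
... | inj₂ x∈q = contradiction x∈q x∉q

x∈p∪q∧x∉p⇒x∈q : x ∈ p ∪ q → x ∉ p → x ∈ q
x∈p∪q∧x∉p⇒x∈q {p = p} {q = q} x∈p∪q x∉p with x∈p∪q⁻ p q x∈p∪q
... | inj₁ x∈p = contradiction x∈p x∉p
... | inj₂ x∈q = x∈q

x∈p∧x∉q⇒p⊈q : x ∈ p → x ∉ q → p ⊈ q
x∈p∧x∉q⇒p⊈q x∈p x∉q p⊆q = x∉q (p⊆q x∈p)

x∉p∪q⇒x∉p : x ∉ p ∪ q → x ∉ p
x∉p∪q⇒x∉p x∉p∪q x∈p = x∉p∪q (x∈p∪q⁺ (inj₁ x∈p))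

x∉p∪q⇒x∉q : x ∉ p ∪ q → x ∉ q
x∉p∪q⇒x∉q x∉p∪q x∈q = x∉p∪q (x∈p∪q⁺ (inj₂ x∈q))

⊆⊎∃∈∉ : (p q : Subset n) → p ⊆ q ⊎ ∃[ x ] (x ∈ p × x ∉ q)
⊆⊎∃∈∉ p q with nonempty? (p ─ q)
... | yes (x , x∈p─q) = inj₂ (x , p─q⊆p p q x∈p─q , x∈p─q⇒x∉q p q x∈p─q)
... | no p─q-empty = inj₁ p⊆q
  where
  p⊆q : p ⊆ q
  p⊆q {x} x∈p with x ∈? q
  ... | yes x∈q = x∈q
  ... | no x∉q = contradiction (x , x∈p∧x∉q⇒x∈p─q x∈p x∉q) p─q-empty

≬-intro : x ∈ p → x ∈ q → ∀ {y z} → y ∈ p → y ∉ q → z ∈ q → z ∉ p → p ≬ q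
≬-intro x∈p x∈q y∈p y∉q z∈q z∉p =
  (_ , x∈p∩q⁺ (x∈p , x∈q)) , (_ , x∈p∧x∉q⇒x∈p─q y∈p y∉q) , (_ , x∈p∧x∉q⇒x∈p─q z∈q z∉p)

≬-sym : p ≬ q → q ≬ p
≬-sym {p = p} {q = q} ((x , x∈p∩q) , p─q , q─p) with x∈p∩q⁻ p q x∈p∩q
... | x∈p , x∈q = (x , x∈p∩q⁺ (x∈q , x∈p)) , q─p , p─q

L1⇒⊆∪ : {𝒞 : SetSystem n} → L1 𝒞 → ∀ {X D Y} → 𝒞 X → 𝒞 D → 𝒞 Y →
        X ≬ D → D ≬ Y → X ⊈ Y → Y ⊈ X → D ⊆ X ∪ Y
L1⇒⊆∪ l1 cX cD cY X≬D D≬Y X⊈Y Y⊈X with l1 _ _ _ cX cD cY X≬D D≬Y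
... | inj₁ X⊆Y = ⊥-elim (X⊈Y X⊆Y)
... | inj₂ (inj₁ Y⊆X) = ⊥-elim (Y⊈X Y⊆X)
... | inj₂ (inj₂ (_ , D⊆X∪Y)) = D⊆X∪Y

module _ {𝒞 : SetSystem n} (l1 : L1 𝒞) {A B C D : Subset n}
         (cA : 𝒞 A) (cB : 𝒞 B) (cC : 𝒞 C) (cD : 𝒞 D)
         (A≬D : A ≬ D) (B≬D : B ≬ D) (C≬D : C ≬ D)
         {a b c : Fin n}
         (a∈A : a ∈ A) (a∉B∪C : a ∉ B ∪ C)
         (b∈B : b ∈ B) (b∉A∪C : b ∉ A ∪ C)
         (c∈C : c ∈ C) (c∉A∪B : c ∉ A ∪ B) where

  private
    a∉B : a ∉ B
    a∉B = x∉p∪q⇒x∉p a∉B∪C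
    a∉C : a ∉ C
    a∉C = x∉p∪q⇒x∉q a∉B∪C
    b∉A : b ∉ A
    b∉A = x∉p∪q⇒x∉p b∉A∪C
    b∉C : b ∉ C
    b∉C = x∉p∪q⇒x∉q b∉A∪C
    c∉A : c ∉ A
    c∉A = x∉p∪q⇒x∉p c∉A∪B
    c∉B : c ∉ B
    c∉B = x∉p∪q⇒x∉q c∉A∪B

    D⊆A∪B : D ⊆ A ∪ B
    D⊆A∪B = L1⇒⊆∪ l1 cA cD cB A≬D (≬-sym B≬D)
      (x∈p∧x∉q⇒p⊈q a∈A a∉B) (x∈p∧x∉q⇒p⊈q b∈B b∉A)

    D⊆A∪C : D ⊆ A ∪ C
    D⊆A∪C = L1⇒⊆∪ l1 cA cD cC A≬D (≬-sym C≬D)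
      (x∈p∧x∉q⇒p⊈q a∈A a∉C) (x∈p∧x∉q⇒p⊈q c∈C c∉A)

    D⊆B∪C : D ⊆ B ∪ C
    D⊆B∪C = L1⇒⊆∪ l1 cB cD cC B≬D (≬-sym C≬D)
      (x∈p∧x∉q⇒p⊈q b∈B b∉C) (x∈p∧x∉q⇒p⊈q c∈C c∉B)

    A≬B : A ≬ B
    A≬B with proj₂ (proj₂ C≬D)
    ... | d , d∈D─C = ≬-intro
      (x∈p∪q∧x∉q⇒x∈p (D⊆A∪C d∈D) d∉C) (x∈p∪q∧x∉q⇒x∈p (D⊆B∪C d∈D) d∉C)
      a∈A a∉B b∈B b∉A
      where
      d∈D : d ∈ D
      d∈D = p─q⊆p D C d∈D─C
      d∉C : d ∉ C
      d∉C = x∈p─q⇒x∉q D C d∈D─C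

    B≬C : B ≬ C
    B≬C with proj₂ (proj₂ A≬D)
    ... | d , d∈D─A = ≬-intro
      (x∈p∪q∧x∉p⇒x∈q (D⊆A∪B d∈D) d∉A) (x∈p∪q∧x∉p⇒x∈q (D⊆A∪C d∈D) d∉A)
      b∈B b∉C c∈C c∉B
      where
      d∈D : d ∈ D
      d∈D = p─q⊆p D A d∈D─A
      d∉A : d ∉ A
      d∉A = x∈p─q⇒x∉q D A d∈D─A

  private-points-contradict-L1 : ⊥
  private-points-contradict-L1 with l1 A B C cA cB cC A≬B B≬C
  ... | inj₁ A⊆C = a∉C (A⊆C a∈A)
  ... | inj₂ (inj₁ C⊆A) = c∉A (C⊆A c∈C)
  ... | inj₂ (inj₂ (_ , B⊆A∪C)) with x∈p∪q⁻ A C (B⊆A∪C b∈B)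
  ... | inj₁ b∈A = b∉A b∈A
  ... | inj₂ b∈C = b∉C b∈C

mainTheorem19 : (n : ℕ) (𝒞 : SetSystem n) → L1 𝒞 → P2 𝒞
mainTheorem19 n 𝒞 l1 A B C D cA cB cC cD A≬D B≬D C≬D
  with ⊆⊎∃∈∉ A (D ∪ B ∪ C) | ⊆⊎∃∈∉ B (D ∪ A ∪ C) | ⊆⊎∃∈∉ C (D ∪ A ∪ B)
... | inj₁ A⊆D∪B∪C | _ | _ = inj₁ A⊆D∪B∪C
... | inj₂ _ | inj₁ B⊆D∪A∪C | _ = inj₂ (inj₁ B⊆D∪A∪C)
... | inj₂ _ | inj₂ _ | inj₁ C⊆D∪A∪B = inj₂ (inj₂ C⊆D∪A∪B)
... | inj₂ (a , a∈A , a∉D∪B∪C) | inj₂ (b , b∈B , b∉D∪A∪C) | inj₂ (c , c∈C , c∉D∪A∪B) =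
  ⊥-elim (private-points-contradict-L1 l1 cA cB cC cD A≬D B≬D C≬D
    a∈A (x∉p∪q⇒x∉q a∉D∪B∪C) b∈B (x∉p∪q⇒x∉q b∉D∪A∪C) c∈C (x∉p∪q⇒x∉q c∉D∪A∪B))
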